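{- For integers $m\ge1$, $n\ge0$, $k\ge0$, let $S^{(m)}(n,k)$ be the number of $k$-element subsets of $\{1,\ldots,n\}$ such that no two elements of the subset differ by $m$. Then $S^{(m)}(n,k)=\left\langle {n+m-k \atop k}\right\rangle_m$.
   Context: An $N$-board is a linear array of $N$ unit cells. A square is a $1\times1$ tile; a $(1,m-1)$-fence is a tile consisting of two unit square posts separated by a gap of width $m-1$, whose gap may be occupied by other tiles. $\left\langle {n \atop k}\right\rangle_m$ denotes the number of tilings of an $(n+k)$-board using exactly $k$ $(1,m-1)$-fences and $n-k$ squares (zero if $k>n$). -}

module Defs where

open import Data.Nat using (ℕ; zero; suc; _+_; _∸_; _≡ᵇ_)
open import Data.Bool using (Bool; true; false; _∧_; _∨_; not; if_then_else_)
open import Data.List using (List; []; _∷_; map; concatMap; filter; length; upTo)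
open import Data.Bool.ListAction using (all; any)
open import Data.Vec using (Vec; []; _∷_)
open import Data.Maybe using (Maybe; just; nothing)

allVecs : {A : Set} → List A → (N : ℕ) → List (Vec A N)
allVecs as zero    = [] ∷ []
allVecs as (suc N) = concatMap (λ a → map (a ∷_) (allVecs as N)) as

count : {A : Set} → (A → Bool) → List A → ℕ
count p xs = length (filter (λ x → Data.Bool.T? (p x)) xs)
  where import Data.Bool

get : {A : Set} {N : ℕ} → Vec A N → ℕ → Maybe A
get []       _       = nothing
get (x ∷ xs) zero    = just x
get (x ∷ xs) (suc i) = get xs i

-- A tiling is recorded cell by cell (cells 0..N-1): each cell is either
-- a square, the left post of a fence, or the right post of a fence.
-- A fence with left post in cell i has its right post in cell i+m
-- (the two posts are separated by a gap of width m-1).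

data Cell : Set where
  sq lp rp : Cell

allCells : List Cell
allCells = sq ∷ lp ∷ rp ∷ []

isLp : Maybe Cell → Bool
isLp (just lp) = true
isLp _         = false

isRp : Maybe Cell → Bool
isRp (just rp) = true
isRp _         = false

validTiling : (m : ℕ) {N : ℕ} → Vec Cell N → Bool
validTiling m {N} v = all ok (upTo N)
  where
    ok : ℕ → Bool
    ok i = (not (isLp (get v i)) ∨ isRp (get v (i + m)))
         ∧ (not (isRp (get v i)) ∨ any (λ j → (j + m ≡ᵇ i) ∧ isLp (get v j)) (upTo i))

numFences : {N : ℕ} → Vec Cell N → ℕ
numFences []       = 0
numFences (lp ∷ v) = suc (numFences v)
numFences (_ ∷ v)  = numFences v

-- ⟨ n over k ⟩_m : number of tilings of an (n+k)-board using exactly k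
-- (1,m-1)-fences (and hence n-k squares; zero if k > n).
fenceNum : (m n k : ℕ) → ℕ
fenceNum m n k =
  count (λ v → validTiling m v ∧ (numFences v ≡ᵇ k)) (allVecs allCells (n + k))

-- S^(m)(n,k): subsets of {1,...,n} as characteristic vectors
-- (entry at position j says whether j+1 is in the subset).

size : {n : ℕ} → Vec Bool n → ℕ
size []          = 0
size (true ∷ v)  = suc (size v)
size (false ∷ v) = size v

isIn : {n : ℕ} → Vec Bool n → ℕ → Bool
isIn v j with get v j
... | just b  = b
... | nothing = false

noDiff : (m : ℕ) {n : ℕ} → Vec Bool n → Bool
noDiff m {n} v = all (λ i → not (isIn v i ∧ isIn v (i + m))) (upTo n)

S : (m n k : ℕ) → ℕ
S m n k = count (λ v → noDiff m v ∧ (size v ≡ᵇ k)) (allVecs (false ∷ true ∷ []) n)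

-- A tiling of an N-board by squares and (1,m-1)-fences is determined by the
-- set of cells holding a left post: the right posts sit exactly m cells
-- further, and every other cell is a square.  A set of cells arises in this
-- way iff each element is followed by a cell of the board m steps further on
-- and no right post lands on a left post, i.e. iff it is a subset of
-- {0,…,N-m-1} in which no two elements differ by m.  So tilings of an
-- (n+m)-board with k fences correspond to the k-subsets counted by S(n,k);
-- the (n+m-k)+k-board of the statement is that board whenever k ≤ n+m, and
-- otherwise both sides vanish.
module Submission where

open import Defs
open import Data.Bool using (Bool; true; false; _∧_; _∨_; not; T)
open import Data.Bool.ListAction using (any; or)
open import Data.Bool.Properties using (T-∧; T-≡; ∧-zeroʳ) renaming (_≟_ to _≟ᵇ_)
open import Data.List using (List; []; _∷_; _++_; map; concatMap; length; upTo)
open import Data.List.Properties using (map-cong; filter-none)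
open import Data.List.Relation.Unary.All as All using ()
open import Data.List.Relation.Unary.All.Properties using (all⁺; all⁻; applyUpTo⁺₁; applyUpTo⁻)
open import Data.List.Relation.Unary.Any.Properties as Any using (any⁺; any⁻)
open import Data.Maybe using (Maybe; just; nothing)
open import Data.Nat
  using (ℕ; zero; suc; _+_; _∸_; _≤_; _<_; _≡ᵇ_; _<?_; _≤?_; z≤n; s≤s; z<s; >-nonZero)
open import Data.Nat.Properties
open import Algebra.Properties.CommutativeSemigroup +-commutativeSemigroup using (interchange)
open import Data.Product using (_×_; _,_; proj₁; proj₂; ∃-syntax)
open import Data.Vec using (Vec; []; _∷_)
open import Data.Vec.Properties using (≡-dec)
open import Function using (id; _∘_; _⇔_; mk⇔; Equivalence)
import Function.Properties.Equivalence as ⇔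
open import Relation.Binary.Definitions using (DecidableEquality)
open import Relation.Binary.PropositionalEquality
  using (_≡_; _≢_; _≗_; refl; sym; trans; cong; cong₂; subst; module ≡-Reasoning)
open import Relation.Nullary using (¬_; yes; no; does; contradiction)
open import Relation.Nullary.Decidable using (T?; _×-dec_; does-⇔; dec-false)

open Equivalence using (to; from)

private
  variable
    A B : Set

T-⇔⇒≡ : {a b : Bool} → T a ⇔ T b → a ≡ b
T-⇔⇒≡ {a} {b} e = does-⇔ e (T? a) (T? b)

T-not : {b : Bool} → T (not b) ⇔ (¬ T b)
T-not {true}  = mk⇔ (λ ()) (λ ¬t → ¬t _)
T-not {false} = mk⇔ (λ _ ()) _

T-implies : {a b : Bool} → T (not a ∨ b) ⇔ (T a → T b)
T-implies {true}  = mk⇔ (λ t _ → t) (λ f → f _)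
T-implies {false} = mk⇔ (λ _ ()) _

-- Sums over lists and double counting

𝟙 : Bool → ℕ
𝟙 true  = 1
𝟙 false = 0

∑ : List A → (A → ℕ) → ℕ
∑ []       h = 0
∑ (x ∷ xs) h = h x + ∑ xs h

count≡∑ : (p : A → Bool) (xs : List A) → count p xs ≡ ∑ xs (𝟙 ∘ p)
count≡∑ p []       = refl
count≡∑ p (x ∷ xs) with p x
... | true  = cong suc (count≡∑ p xs)
... | false = count≡∑ p xs

∑-cong : (xs : List A) {h h′ : A → ℕ} → h ≗ h′ → ∑ xs h ≡ ∑ xs h′
∑-cong []       e = refl
∑-cong (x ∷ xs) e = cong₂ _+_ (e x) (∑-cong xs e)

∑-++ : (xs ys : List A) (h : A → ℕ) → ∑ (xs ++ ys) h ≡ ∑ xs h + ∑ ys h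
∑-++ []       ys h = refl
∑-++ (x ∷ xs) ys h = trans (cong (h x +_) (∑-++ xs ys h)) (sym (+-assoc (h x) _ _))

∑-map : (f : A → B) (xs : List A) (h : B → ℕ) → ∑ (map f xs) h ≡ ∑ xs (h ∘ f)
∑-map f []       h = refl
∑-map f (x ∷ xs) h = cong (h (f x) +_) (∑-map f xs h)

∑-concatMap : (f : A → List B) (xs : List A) (h : B → ℕ) →
              ∑ (concatMap f xs) h ≡ ∑ xs (λ x → ∑ (f x) h)
∑-concatMap f []       h = refl
∑-concatMap f (x ∷ xs) h =
  trans (∑-++ (f x) (concatMap f xs) h) (cong (∑ (f x) h +_) (∑-concatMap f xs h))

∑-zero : (xs : List A) → ∑ xs (λ _ → 0) ≡ 0
∑-zero []       = refl
∑-zero (x ∷ xs) = ∑-zero xs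

∑-+ : (xs : List A) (h h′ : A → ℕ) → ∑ xs (λ x → h x + h′ x) ≡ ∑ xs h + ∑ xs h′
∑-+ []       h h′ = refl
∑-+ (x ∷ xs) h h′ =
  trans (cong (h x + h′ x +_) (∑-+ xs h h′)) (interchange (h x) (h′ x) (∑ xs h) (∑ xs h′))

∑-swap : (xs : List A) (ys : List B) (h : A → B → ℕ) →
         ∑ xs (λ x → ∑ ys (h x)) ≡ ∑ ys (λ y → ∑ xs (λ x → h x y))
∑-swap []       ys h = sym (∑-zero ys)
∑-swap (x ∷ xs) ys h =
  trans (cong (∑ ys (h x) +_) (∑-swap xs ys h)) (sym (∑-+ ys (h x) _))

IsListing : DecidableEquality A → List A → Set
IsListing _≟_ xs = ∀ w → count (λ x → does (x ≟ w)) xs ≡ 1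

∑-select : (_≟_ : DecidableEquality A) (xs : List A) → IsListing _≟_ xs →
           ∀ b w → ∑ xs (λ x → 𝟙 (b ∧ does (x ≟ w))) ≡ 𝟙 b
∑-select _≟_ xs listing true  w = trans (sym (count≡∑ _ xs)) (listing w)
∑-select _≟_ xs listing false w = ∑-zero xs

allVecs-isListing : (_≟_ : DecidableEquality A) (as : List A) → IsListing _≟_ as →
                    ∀ N → IsListing (≡-dec _≟_) (allVecs as N)
allVecs-isListing _≟_ as listing zero    []      = refl
allVecs-isListing _≟_ as listing (suc N) (c ∷ w) = begin
  count (λ v → does (≡-dec _≟_ v (c ∷ w))) (allVecs as (suc N))
    ≡⟨ count≡∑ _ (allVecs as (suc N)) ⟩
  ∑ (concatMap (λ a → map (a ∷_) (allVecs as N)) as) (λ v → 𝟙 (does (≡-dec _≟_ v (c ∷ w))))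
    ≡⟨ ∑-concatMap _ as _ ⟩
  ∑ as (λ a → ∑ (map (a ∷_) (allVecs as N)) (λ v → 𝟙 (does (≡-dec _≟_ v (c ∷ w)))))
    ≡⟨ ∑-cong as (λ a → ∑-map (a ∷_) (allVecs as N) _) ⟩
  ∑ as (λ a → ∑ (allVecs as N) (λ v → 𝟙 (does (a ≟ c) ∧ does (≡-dec _≟_ v w))))
    ≡⟨ ∑-cong as (λ a → ∑-select (≡-dec _≟_) (allVecs as N) (allVecs-isListing _≟_ as listing N)
                                 (does (a ≟ c)) w) ⟩
  ∑ as (λ a → 𝟙 (does (a ≟ c)))
    ≡⟨ count≡∑ _ as ⟨
  count (λ a → does (a ≟ c)) as
    ≡⟨ listing c ⟩
  1 ∎
  where open ≡-Reasoning

-- Σₓ Σ_y [P x ∧ y = g x] = Σ_y Σₓ [Q y ∧ x = f y], and the two brackets agree.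
count-bijection : (_≟ᴬ_ : DecidableEquality A) (_≟ᴮ_ : DecidableEquality B)
                  (xs : List A) (ys : List B) → IsListing _≟ᴬ_ xs → IsListing _≟ᴮ_ ys →
                  {P : A → Bool} {Q : B → Bool} (f : B → A) (g : A → B) →
                  (∀ x → T (P x) → f (g x) ≡ x) →
                  (∀ y → P (f y) ≡ Q y) →
                  (∀ y → T (Q y) → g (f y) ≡ y) →
                  count P xs ≡ count Q ys
count-bijection _≟ᴬ_ _≟ᴮ_ xs ys xs-listing ys-listing {P} {Q} f g fg≡id P∘f≡Q gf≡id = begin
  count P xs
    ≡⟨ count≡∑ P xs ⟩
  ∑ xs (𝟙 ∘ P)
    ≡⟨ ∑-cong xs (λ x → ∑-select _≟ᴮ_ ys ys-listing (P x) (g x)) ⟨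
  ∑ xs (λ x → ∑ ys (λ y → 𝟙 (P x ∧ does (y ≟ᴮ g x))))
    ≡⟨ ∑-swap xs ys _ ⟩
  ∑ ys (λ y → ∑ xs (λ x → 𝟙 (P x ∧ does (y ≟ᴮ g x))))
    ≡⟨ ∑-cong ys (λ y → ∑-cong xs (λ x → cong 𝟙 (same-pairs x y))) ⟩
  ∑ ys (λ y → ∑ xs (λ x → 𝟙 (Q y ∧ does (x ≟ᴬ f y))))
    ≡⟨ ∑-cong ys (λ y → ∑-select _≟ᴬ_ xs xs-listing (Q y) (f y)) ⟩
  ∑ ys (𝟙 ∘ Q)
    ≡⟨ count≡∑ Q ys ⟨
  count Q ys ∎
  where
  open ≡-Reasoning
  same-pairs : ∀ x y → P x ∧ does (y ≟ᴮ g x) ≡ Q y ∧ does (x ≟ᴬ f y)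
  same-pairs x y =
    does-⇔ (mk⇔ forth back) (T? (P x) ×-dec (y ≟ᴮ g x)) (T? (Q y) ×-dec (x ≟ᴬ f y))
    where
    forth : T (P x) × y ≡ g x → T (Q y) × x ≡ f y
    forth (px , refl) = subst T (trans (cong P (sym (fg≡id x px))) (P∘f≡Q y)) px , sym (fg≡id x px)
    back : T (Q y) × x ≡ f y → T (P x) × y ≡ g x
    back (qy , refl) = subst T (sym (P∘f≡Q y)) qy , sym (gf≡id y qy)

tabulateℕ : (n : ℕ) → (ℕ → A) → Vec A n
tabulateℕ zero    h = []
tabulateℕ (suc n) h = h 0 ∷ tabulateℕ n (h ∘ suc)

get-tabulateℕ : (n : ℕ) (h : ℕ → A) {i : ℕ} → i < n → get (tabulateℕ n h) i ≡ just (h i)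
get-tabulateℕ (suc n) h {zero}  _         = refl
get-tabulateℕ (suc n) h {suc i} (s≤s i<n) = get-tabulateℕ n (h ∘ suc) i<n

get-≥ : {n : ℕ} (v : Vec A n) {i : ℕ} → n ≤ i → get v i ≡ nothing
get-≥ []      _         = refl
get-≥ (x ∷ v) (s≤s n≤i) = get-≥ v n≤i

tabulateℕ-cong : (n : ℕ) {h h′ : ℕ → A} → (∀ {i} → i < n → h i ≡ h′ i) →
                 tabulateℕ n h ≡ tabulateℕ n h′
tabulateℕ-cong zero    e = refl
tabulateℕ-cong (suc n) e = cong₂ _∷_ (e (s≤s z≤n)) (tabulateℕ-cong n (e ∘ s≤s))

tabulateℕ-get : {n : ℕ} (v : Vec A n) {h : ℕ → A} →
                (∀ {i a} → get v i ≡ just a → h i ≡ a) → tabulateℕ n h ≡ v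
tabulateℕ-get []      e = refl
tabulateℕ-get (a ∷ v) e = cong₂ _∷_ (e refl) (tabulateℕ-get v (λ {i} → e {suc i}))

isIn-just : {n : ℕ} (y : Vec Bool n) {i : ℕ} {b : Bool} → get y i ≡ just b → isIn y i ≡ b
isIn-just y {i} eq with get y i
isIn-just y refl | just _ = refl

isIn-≥ : {n : ℕ} (y : Vec Bool n) {i : ℕ} → n ≤ i → isIn y i ≡ false
isIn-≥ y n≤i rewrite get-≥ y n≤i = refl

isIn⇒< : {n : ℕ} (y : Vec Bool n) {i : ℕ} → T (isIn y i) → i < n
isIn⇒< {n} y {i} t with i <? n
... | yes i<n = i<n
... | no  i≮n = contradiction (subst T (isIn-≥ y (≮⇒≥ i≮n)) t) λ ()

isIn-tabulateℕ : (n : ℕ) {h : ℕ → Bool} → (∀ i → T (h i) → i < n) → isIn (tabulateℕ n h) ≗ h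
isIn-tabulateℕ n {h} h⇒< i with i <? n
... | yes i<n = isIn-just (tabulateℕ n h) (get-tabulateℕ n h i<n)
... | no  i≮n = trans (isIn-≥ (tabulateℕ n h) (≮⇒≥ i≮n))
                      (sym (dec-false (T? (h i)) (i≮n ∘ h⇒< i)))

tabulateℕ-isIn : {n : ℕ} (y : Vec Bool n) → tabulateℕ n (isIn y) ≡ y
tabulateℕ-isIn y = tabulateℕ-get y (isIn-just y)

size-cong : {n n′ : ℕ} (y : Vec Bool n) (y′ : Vec Bool n′) → isIn y ≗ isIn y′ → size y ≡ size y′
size-cong []      []       e = refl
size-cong []      (b ∷ y′) e rewrite sym (e 0) = size-cong [] y′ (e ∘ suc)
size-cong (b ∷ y) []       e rewrite e 0       = size-cong y [] (e ∘ suc)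
size-cong (b ∷ y) (b′ ∷ y′) e with e 0
size-cong (true  ∷ y) (true  ∷ y′) e | refl = cong suc (size-cong y y′ (e ∘ suc))
size-cong (false ∷ y) (false ∷ y′) e | refl = size-cong y y′ (e ∘ suc)

size≤length : {n : ℕ} (y : Vec Bool n) → size y ≤ n
size≤length []          = z≤n
size≤length (true  ∷ y) = s≤s (size≤length y)
size≤length (false ∷ y) = m≤n⇒m≤1+n (size≤length y)

-- `shifted m p i`: p holds at i - m (the right-post test of `validTiling`).

shifted : ℕ → (ℕ → Bool) → ℕ → Bool
shifted m p i = any (λ j → (j + m ≡ᵇ i) ∧ p j) (upTo i)

shifted-cong : (m : ℕ) {p q : ℕ → Bool} → p ≗ q → shifted m p ≗ shifted m q
shifted-cong m p≗q i = cong or (map-cong (λ j → cong ((j + m ≡ᵇ i) ∧_) (p≗q j)) (upTo i))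

shifted⇒ : (m : ℕ) (p : ℕ → Bool) {i : ℕ} → T (shifted m p i) → ∃[ j ] j + m ≡ i × T (p j)
shifted⇒ m p {i} t with Any.applyUpTo⁻ id (any⁻ _ (upTo i) t)
... | j , _ , t′ = j , ≡ᵇ⇒≡ (j + m) i (proj₁ (T-∧ .to t′)) , proj₂ (T-∧ .to t′)

shifted-+ : {m : ℕ} → 1 ≤ m → (p : ℕ → Bool) (j : ℕ) → shifted m p (j + m) ≡ p j
shifted-+ {m} 1≤m p j = T-⇔⇒≡ (mk⇔ forth back)
  where
  forth : T (shifted m p (j + m)) → T (p j)
  forth t with shifted⇒ m p {j + m} t
  ... | j′ , j′+m≡j+m , pj′ = subst (T ∘ p) (+-cancelʳ-≡ m j′ j j′+m≡j+m) pj′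
  back : T (p j) → T (shifted m p (j + m))
  back pj = any⁺ _ (Any.applyUpTo⁺ id (T-∧ .from (≡⇒≡ᵇ (j + m) (j + m) refl , pj)) (m<m+n j 1≤m))

-- Tilings and their left posts

lpAt rpAt : {N : ℕ} → Vec Cell N → ℕ → Bool
lpAt v i = isLp (get v i)
rpAt v i = isRp (get v i)

T-get⇒< : {N : ℕ} (v : Vec Cell N) (q : Maybe Cell → Bool) → q nothing ≡ false →
          ∀ {i} → T (q (get v i)) → i < N
T-get⇒< {N} v q q-nothing {i} t with i <? N
... | yes i<N = i<N
... | no  i≮N = contradiction (subst T (trans (cong q (get-≥ v (≮⇒≥ i≮N))) q-nothing) t) λ ()

record IsTiling (m : ℕ) {N : ℕ} (v : Vec Cell N) : Set where
  field
    lp⇒rp : ∀ i → T (lpAt v i) → T (rpAt v (i + m))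
    rp⇒lp : ∀ i → T (rpAt v i) → T (shifted m (lpAt v) i)
open IsTiling

validTiling⇔IsTiling : (m : ℕ) {N : ℕ} (v : Vec Cell N) → T (validTiling m v) ⇔ IsTiling m v
validTiling⇔IsTiling m {N} v = mk⇔ forth back
  where
  forth : T (validTiling m v) → IsTiling m v
  forth valid = record
    { lp⇒rp = λ i lpi → T-implies .to (proj₁ (T-∧ .to (ok (T-get⇒< v isLp refl lpi)))) lpi
    ; rp⇒lp = λ i rpi → T-implies .to (proj₂ (T-∧ .to (ok (T-get⇒< v isRp refl rpi)))) rpi
    }
    where ok = applyUpTo⁻ id N (all⁺ _ (upTo N) valid)
  back : IsTiling m v → T (validTiling m v)
  back t = all⁻ _ (applyUpTo⁺₁ id N (λ {i} _ →
    T-∧ .from (T-implies .from (lp⇒rp t i) , T-implies .from (rp⇒lp t i))))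

NoDiff : ℕ → (ℕ → Bool) → Set
NoDiff m p = ∀ i → ¬ (T (p i) × T (p (i + m)))

noDiff⇔NoDiff : (m : ℕ) {n : ℕ} (y : Vec Bool n) → T (noDiff m y) ⇔ NoDiff m (isIn y)
noDiff⇔NoDiff m {n} y = mk⇔ forth back
  where
  forth : T (noDiff m y) → NoDiff m (isIn y)
  forth nd i both@(yi , _) =
    T-not .to (applyUpTo⁻ id n (all⁺ _ (upTo n) nd) (isIn⇒< y yi)) (T-∧ .from both)
  back : NoDiff m (isIn y) → T (noDiff m y)
  back nd = all⁻ _ (applyUpTo⁺₁ id n (λ {i} _ → T-not .from (nd i ∘ T-∧ .to)))

Fits : (m N : ℕ) → (ℕ → Bool) → Set
Fits m N p = ∀ i → T (p i) → i + m < N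

cellOf : Bool → Bool → Cell
cellOf true  _     = lp
cellOf false true  = rp
cellOf false false = sq

isLp-cellOf : ∀ a b → isLp (just (cellOf a b)) ≡ a
isLp-cellOf true  _     = refl
isLp-cellOf false true  = refl
isLp-cellOf false false = refl

isRp-cellOf : ∀ a b → isRp (just (cellOf a b)) ≡ not a ∧ b
isRp-cellOf true  _     = refl
isRp-cellOf false true  = refl
isRp-cellOf false false = refl

module _ (m : ℕ) where

  fromLeftPosts : (N : ℕ) → (ℕ → Bool) → Vec Cell N
  fromLeftPosts N p = tabulateℕ N (λ i → cellOf (p i) (shifted m p i))

  leftPosts : {N : ℕ} → Vec Cell N → Vec Bool (N ∸ m)
  leftPosts {N} v = tabulateℕ (N ∸ m) (lpAt v)

  fromLeftPosts-cong : (N : ℕ) {p q : ℕ → Bool} → p ≗ q → fromLeftPosts N p ≡ fromLeftPosts N q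
  fromLeftPosts-cong N p≗q = tabulateℕ-cong N (λ {i} _ → cong₂ cellOf (p≗q i) (shifted-cong m p≗q i))

  module _ {N : ℕ} {p : ℕ → Bool} (fits : Fits m N p) where

    shifted⇒< : ∀ {i} → T (shifted m p i) → i < N
    shifted⇒< {i} t with shifted⇒ m p {i} t
    ... | j , refl , pj = fits j pj

    lpAt-fromLeftPosts : lpAt (fromLeftPosts N p) ≗ p
    lpAt-fromLeftPosts i with i <? N
    ... | yes i<N rewrite get-tabulateℕ N (λ i → cellOf (p i) (shifted m p i)) i<N = isLp-cellOf (p i) _
    ... | no  i≮N rewrite get-≥ (fromLeftPosts N p) (≮⇒≥ i≮N) =
      sym (dec-false (T? (p i)) (i≮N ∘ m+n≤o⇒m≤o (suc i) ∘ fits i))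

    rpAt-fromLeftPosts : ∀ i → rpAt (fromLeftPosts N p) i ≡ not (p i) ∧ shifted m p i
    rpAt-fromLeftPosts i with i <? N
    ... | yes i<N rewrite get-tabulateℕ N (λ i → cellOf (p i) (shifted m p i)) i<N = isRp-cellOf (p i) _
    ... | no  i≮N rewrite get-≥ (fromLeftPosts N p) (≮⇒≥ i≮N)
                        | dec-false (T? (shifted m p i)) (i≮N ∘ shifted⇒<) = sym (∧-zeroʳ (not (p i)))

    fromLeftPosts-IsTiling⇔NoDiff : 1 ≤ m → IsTiling m (fromLeftPosts N p) ⇔ NoDiff m p
    fromLeftPosts-IsTiling⇔NoDiff 1≤m = mk⇔ forth back
      where
      rpAt-+ : ∀ i → rpAt (fromLeftPosts N p) (i + m) ≡ not (p (i + m)) ∧ p i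
      rpAt-+ i = trans (rpAt-fromLeftPosts (i + m)) (cong (not (p (i + m)) ∧_) (shifted-+ 1≤m p i))
      forth : IsTiling m (fromLeftPosts N p) → NoDiff m p
      forth t i (pi , pi+m) = T-not .to (proj₁ (T-∧ .to rp-i+m)) pi+m
        where rp-i+m = subst T (rpAt-+ i) (lp⇒rp t i (subst T (sym (lpAt-fromLeftPosts i)) pi))
      back : NoDiff m p → IsTiling m (fromLeftPosts N p)
      back nd = record
        { lp⇒rp = λ i lpi → let pi = subst T (lpAt-fromLeftPosts i) lpi in
            subst T (sym (rpAt-+ i)) (T-∧ .from (T-not .from (λ pi+m → nd i (pi , pi+m)) , pi))
        ; rp⇒lp = λ i rpi → subst T (sym (shifted-cong m lpAt-fromLeftPosts i))
            (proj₂ (T-∧ .to (subst T (rpAt-fromLeftPosts i) rpi)))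
        }

  module _ {N : ℕ} {v : Vec Cell N} (tiling : IsTiling m v) where

    shifted⇒rpAt : ∀ {i} → T (shifted m (lpAt v) i) → T (rpAt v i)
    shifted⇒rpAt {i} s with shifted⇒ m (lpAt v) {i} s
    ... | j , refl , lpj = lp⇒rp tiling j lpj

    fromLeftPosts-lpAt : fromLeftPosts N (lpAt v) ≡ v
    fromLeftPosts-lpAt = tabulateℕ-get v cell
      where
      cell : ∀ {i c} → get v i ≡ just c → cellOf (lpAt v i) (shifted m (lpAt v) i) ≡ c
      cell {i} {lp} eq rewrite eq = refl
      cell {i} {rp} eq rewrite eq | T-≡ .to (rp⇒lp tiling i (subst (T ∘ isRp) (sym eq) _)) = refl
      cell {i} {sq} eq rewrite eq
                            | dec-false (T? (shifted m (lpAt v) i)) (subst (T ∘ isRp) eq ∘ shifted⇒rpAt) = refl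

    IsTiling⇒Fits : Fits m N (lpAt v)
    IsTiling⇒Fits i lpi = T-get⇒< v isRp refl (lp⇒rp tiling i lpi)

  isIn-leftPosts : {N : ℕ} (v : Vec Cell N) → Fits m N (lpAt v) → isIn (leftPosts v) ≗ lpAt v
  isIn-leftPosts v fits = isIn-tabulateℕ _ (λ i → m+n≤o⇒m≤o∸n (suc i) ∘ fits i)

  numFences≡size : {N : ℕ} (v : Vec Cell N) → numFences v ≡ size (tabulateℕ N (lpAt v))
  numFences≡size []       = refl
  numFences≡size (sq ∷ v) = numFences≡size v
  numFences≡size (lp ∷ v) = cong suc (numFences≡size v)
  numFences≡size (rp ∷ v) = numFences≡size v

  numFences≡size-leftPosts : {N : ℕ} (v : Vec Cell N) → Fits m N (lpAt v) →
                             numFences v ≡ size (leftPosts v)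
  numFences≡size-leftPosts {N} v fits =
    trans (numFences≡size v) (size-cong (tabulateℕ N (lpAt v)) (leftPosts v) λ i →
      trans (isIn-tabulateℕ N (λ i → m+n≤o⇒m≤o (suc i) ∘ fits i) i) (sym (isIn-leftPosts v fits i)))

<∸⇒+< : ∀ {i m N} → i < N ∸ m → i + m < N
<∸⇒+< {i} {m} {N} i<N∸m = m≤o∸n⇒m+n≤o (suc i) (<⇒≤ (m∸n≢0⇒n<m N∸m≢0)) i<N∸m
  where
  N∸m≢0 : N ∸ m ≢ 0
  N∸m≢0 eq = contradiction (subst (i <_) eq i<N∸m) λ ()

_≟ᶜ_ : DecidableEquality Cell
sq ≟ᶜ sq = yes refl
lp ≟ᶜ lp = yes refl
rp ≟ᶜ rp = yes refl
sq ≟ᶜ lp = no λ ()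
sq ≟ᶜ rp = no λ ()
lp ≟ᶜ sq = no λ ()
lp ≟ᶜ rp = no λ ()
rp ≟ᶜ sq = no λ ()
rp ≟ᶜ lp = no λ ()

allCells-isListing : IsListing _≟ᶜ_ allCells
allCells-isListing sq = refl
allCells-isListing lp = refl
allCells-isListing rp = refl

bools-isListing : IsListing _≟ᵇ_ (false ∷ true ∷ [])
bools-isListing false = refl
bools-isListing true  = refl

tilingCount : (m k N : ℕ) → ℕ
tilingCount m k N = count (λ v → validTiling m v ∧ (numFences v ≡ᵇ k)) (allVecs allCells N)

tilingCount≡S : {m : ℕ} → 1 ≤ m → ∀ k N → tilingCount m k N ≡ S m (N ∸ m) k
tilingCount≡S {m} 1≤m k N =
  count-bijection (≡-dec _≟ᶜ_) (≡-dec _≟ᵇ_) (allVecs allCells N) (allVecs (false ∷ true ∷ []) (N ∸ m))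
    (allVecs-isListing _≟ᶜ_ allCells allCells-isListing N)
    (allVecs-isListing _≟ᵇ_ (false ∷ true ∷ []) bools-isListing (N ∸ m))
    tilingOf (leftPosts m)
    (λ v → tilingOf-leftPosts v ∘ proj₁ ∘ T-∧ .to) isKTiling∘tilingOf (λ y _ → leftPosts-tilingOf y)
  where
  isKTiling : Vec Cell N → Bool
  isKTiling v = validTiling m v ∧ (numFences v ≡ᵇ k)

  isKSubset : Vec Bool (N ∸ m) → Bool
  isKSubset y = noDiff m y ∧ (size y ≡ᵇ k)

  tilingOf : Vec Bool (N ∸ m) → Vec Cell N
  tilingOf y = fromLeftPosts m N (isIn y)

  fits : (y : Vec Bool (N ∸ m)) → Fits m N (isIn y)
  fits y i = <∸⇒+< ∘ isIn⇒< y

  tilingOf-leftPosts : (v : Vec Cell N) → T (validTiling m v) → tilingOf (leftPosts m v) ≡ v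
  tilingOf-leftPosts v valid =
    trans (fromLeftPosts-cong m N (isIn-leftPosts m v (IsTiling⇒Fits m tiling))) (fromLeftPosts-lpAt m tiling)
    where tiling = validTiling⇔IsTiling m v .to valid

  leftPosts-tilingOf : (y : Vec Bool (N ∸ m)) → leftPosts m (tilingOf y) ≡ y
  leftPosts-tilingOf y =
    trans (tabulateℕ-cong (N ∸ m) (λ {i} _ → lpAt-fromLeftPosts m (fits y) i)) (tabulateℕ-isIn y)

  isKTiling∘tilingOf : ∀ y → isKTiling (tilingOf y) ≡ isKSubset y
  isKTiling∘tilingOf y = cong₂ _∧_ valid≡noDiff (cong (_≡ᵇ k) numFences≡size-y)
    where
    valid≡noDiff : validTiling m (tilingOf y) ≡ noDiff m y
    valid≡noDiff = T-⇔⇒≡ (⇔.trans (validTiling⇔IsTiling m (tilingOf y))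
                   (⇔.trans (fromLeftPosts-IsTiling⇔NoDiff m (fits y) 1≤m) (⇔.sym (noDiff⇔NoDiff m y))))
    fits-lpAt : Fits m N (lpAt (tilingOf y))
    fits-lpAt i = fits y i ∘ subst T (lpAt-fromLeftPosts m (fits y) i)
    numFences≡size-y : numFences (tilingOf y) ≡ size y
    numFences≡size-y =
      trans (numFences≡size-leftPosts m (tilingOf y) fits-lpAt) (cong size (leftPosts-tilingOf y))

S-empty : ∀ m {n k} → n < k → S m n k ≡ 0
S-empty m {n} {k} n<k =
  cong length (filter-none (T? ∘ isKSubset) (All.universal too-large (allVecs (false ∷ true ∷ []) n)))
  where
  isKSubset : Vec Bool n → Bool
  isKSubset y = noDiff m y ∧ (size y ≡ᵇ k)
  too-large : (y : Vec Bool n) → ¬ T (isKSubset y)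
  too-large y t = <⇒≢ (≤-<-trans (size≤length y) n<k) (≡ᵇ⇒≡ (size y) k (proj₂ (T-∧ .to t)))

corollary17 : (m n k : ℕ) → 1 ≤ m → S m n k ≡ fenceNum m (n + m ∸ k) k
corollary17 m n k 1≤m with k ≤? n + m
... | yes k≤n+m = begin
  S m n k                   ≡⟨ cong (λ l → S m l k) (m+n∸n≡m n m) ⟨
  S m (n + m ∸ m) k         ≡⟨ tilingCount≡S 1≤m k (n + m) ⟨
  tilingCount m k (n + m)   ≡⟨ cong (tilingCount m k) (m∸n+n≡m k≤n+m) ⟨
  fenceNum m (n + m ∸ k) k  ∎
  where open ≡-Reasoning
... | no k≰n+m = begin
  S m n k                   ≡⟨ S-empty m (≤-<-trans (m≤m+n n m) n+m<k) ⟩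
  0                         ≡⟨ S-empty m k∸m<k ⟨
  S m (k ∸ m) k             ≡⟨ tilingCount≡S 1≤m k k ⟨
  tilingCount m k k         ≡⟨ cong (λ l → tilingCount m k (l + k)) (m≤n⇒m∸n≡0 (<⇒≤ n+m<k)) ⟨
  fenceNum m (n + m ∸ k) k  ∎
  where
  open ≡-Reasoning
  n+m<k : n + m < k
  n+m<k = ≰⇒> k≰n+m
  k∸m<k : k ∸ m < k
  k∸m<k = m<n+o⇒m∸n<o k m {{>-nonZero (<-≤-trans z<s n+m<k)}} (m<n+m k 1≤m)
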